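{- Every integer $x$ with $x\geq 2$ and $x\not\equiv 0\pmod 5$ belongs to at least one of the sets $R_i$, $i\ge 1$.
   Context: Define sets of positive integers $R_1,R_2,\dots$ recursively: $R_1=\{2\}$; for each $k\ge 1$, if $x\in R_k$ then $(x+5)^2\in R_{k+1}$; for each $k\ge1$, if $x^2\in R_k$ (with $x$ a positive integer) then $x\in R_{k+1}$. -}

module Defs where

open import Data.Nat using (ℕ; suc; _+_; _*_; _≤_)

-- Levels are indexed from 1 as in the paper:
-- R_1 = {2}; x ∈ R_k ⇒ (x+5)^2 ∈ R_{k+1}; x^2 ∈ R_k (x positive) ⇒ x ∈ R_{k+1}.
data R : ℕ → ℕ → Set where
  base : R 1 2
  sq   : ∀ {k x} → R k x → R (suc k) ((x + 5) * (x + 5))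
  root : ∀ {k x} → 1 ≤ x → R k (x * x) → R (suc k) x

module Submission where

-- Squaring and then taking the root moves x to x + 5, so every member of
-- some R_i generates its whole residue class mod 5 above it.  It remains to
-- reach one seed in each non-zero class: 2 directly, and 3, 4, 6 as square
-- roots obtained from 49 = (2+5)² and its square 2916 = 54² through
--   2916 + 44·5 = 56²,  56 + 5·5 = 9²,  56 + 13·5 = 11²,  11 + 5 = 4²,  11 + 5·5 = 6².

open import Defs
open import Data.Nat using (ℕ; suc; _+_; _*_; _≤_; _%_; s≤s; z≤n)
open import Data.Nat.Properties using (+-identityʳ; +-assoc; +-comm)
open import Data.Nat.DivMod using ([m+n]%n≡m%n)
open import Data.Product using (∃-syntax; _×_; _,_)
open import Function using (_∘_)
open import Relation.Binary.PropositionalEquality using (_≡_; refl; sym; trans; cong; subst)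
open import Relation.Nullary using (¬_)

Reachable : ℕ → Set
Reachable x = ∃[ i ] R i x

R-level-positive : ∀ {i x} → R i x → 1 ≤ i
R-level-positive base       = s≤s z≤n
R-level-positive (sq _)     = s≤s z≤n
R-level-positive (root _ _) = s≤s z≤n

reachable-sq : ∀ {x} → Reachable x → Reachable ((x + 5) * (x + 5))
reachable-sq (_ , r) = _ , sq r

reachable-root : ∀ x → Reachable (suc x * suc x) → Reachable (suc x)
reachable-root _ (_ , r) = _ , root (s≤s z≤n) r

reachable-+5 : ∀ {x} → Reachable x → Reachable (x + 5)
reachable-+5 {x} (_ , r) = _ , root (subst (1 ≤_) (+-comm 5 x) (s≤s z≤n)) (sq r)

reachable-+*5 : ∀ n {x} → Reachable x → Reachable (x + n * 5)
reachable-+*5 0       {x} r = subst Reachable (sym (+-identityʳ x)) r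
reachable-+*5 (suc n) {x} r =
  subst Reachable (+-assoc x 5 (n * 5)) (reachable-+*5 n (reachable-+5 r))

reachable-2 : Reachable 2
reachable-2 = _ , base

reachable-49 : Reachable 49
reachable-49 = reachable-sq reachable-2

reachable-56 : Reachable 56
reachable-56 = reachable-root 55 (reachable-+*5 44 (reachable-sq reachable-49))

reachable-11 : Reachable 11
reachable-11 = reachable-root 10 (reachable-+*5 13 reachable-56)

reachable-3 : Reachable 3
reachable-3 = reachable-root 2 (reachable-root 8 (reachable-+*5 5 reachable-56))

reachable-4 : Reachable 4
reachable-4 = reachable-root 3 (reachable-+5 reachable-11)

reachable-6 : Reachable 6
reachable-6 = reachable-root 5 (reachable-+*5 5 reachable-11)

5∤5+x⇒5∤x : ∀ x → ¬ ((5 + x) % 5 ≡ 0) → ¬ (x % 5 ≡ 0)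
5∤5+x⇒5∤x x 5∤5+x = 5∤5+x ∘ trans (trans (cong (_% 5) (+-comm 5 x)) ([m+n]%n≡m%n x 5))

reachable-of-5∤ : ∀ x → 2 ≤ x → ¬ (x % 5 ≡ 0) → Reachable x
reachable-of-5∤ 1 (s≤s ()) _
reachable-of-5∤ 2 _ _ = reachable-2
reachable-of-5∤ 3 _ _ = reachable-3
reachable-of-5∤ 4 _ _ = reachable-4
reachable-of-5∤ 5 _ 5∤5 with () ← 5∤5 refl
reachable-of-5∤ 6 _ _ = reachable-6
reachable-of-5∤ (suc (suc (suc (suc (suc x@(suc (suc _))))))) _ 5∤5+x =
  subst Reachable (+-comm x 5)
    (reachable-+5 (reachable-of-5∤ x (s≤s (s≤s z≤n)) (5∤5+x⇒5∤x x 5∤5+x)))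

corollary6 : (x : ℕ) → 2 ≤ x → ¬ (x % 5 ≡ 0) → ∃[ i ] (1 ≤ i × R i x)
corollary6 x 2≤x 5∤x with i , r ← reachable-of-5∤ x 2≤x 5∤x = i , R-level-positive r , r
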